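{- Let $n\ge0$, $0\le m\le 2^n-1$, and write $\{m\}_n=1^{k_0}0^{k_1}\cdots0^{k_{l-2}}1^{k_{l-1}}$ with $l$ odd, $k_0\ge0$, $k_i\ge1$ ($i=1,\dots,l-2$), $k_{l-1}\ge0$. Then: (1)(i) if $k_{l-1}\ge1$, then $[2^n:m]=\prod_{j=0}^{l-1}CF(k_j,k_{j+1},\dots,k_{l-1})$; (1)(ii) if $k_{l-1}=0$ and $l\ge3$, then $[2^n:m]=\prod_{j=0}^{l-3}CF(k_j,k_{j+1},\dots,k_{l-3})$; (2)(i) if $k_0\ge1$, then $[2^n:m]=\prod_{j=0}^{l-1}CF(k_j,k_{j-1},\dots,k_0)$; (2)(ii) if $k_0=0$ and $l\ge 3$, then $[2^n:m]=\prod_{j=2}^{l-1}CF(k_j,k_{j-1},\dots,k_2)$; (3)(i) $\dfrac{[2^n:m]}{[2^n:2^n-m]}=CF(k_0,k_1,\dots,k_{l-1})$; (3)(ii) $\dfrac{[2^n:m]}{[2^n:m+1]}=CF(k_{l-1},k_{l-2},\dots,k_0)$.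
   Context: Stern's diatomic integers: for integers $n\ge0$, $0\le m\le 2^n$, define $[2^0:0]=0$, $[2^0:1]=1$, $[2^{n+1}:2m]=[2^n:m]$ ($0\le m\le 2^n$), $[2^{n+1}:2m+1]=[2^n:m]+[2^n:m+1]$ ($0\le m\le 2^n-1$). $\{m\}_n$ is the length-$n$ binary word (leading zeros allowed) representing $m$; $x^k$ denotes $k$ copies of the letter $x$. Continued fractions: for integers $k_0,\dots,k_{l-1}\ge 0$ (with $k_1,\dots,k_{l-2}\ge1$), $CF(k_{l-1})=k_{l-1}$ and $CF(k_j,\dots,k_{l-1})=k_j+1/CF(k_{j+1},\dots,k_{l-1})$, computed from $j=l-2$ down to $0$, with the conventions $1/0=\infty$ and $1/\infty=0$ (so e.g. $CF(k_0,0)=\infty$, $CF(0)=0$). -}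

module Defs where

open import Data.Nat as ℕ using (ℕ; zero; suc; _+_; _∸_; _%_; _≡ᵇ_)
open import Data.Nat.DivMod using (_/_)
open import Data.Integer using (+_)
open import Data.Rational as ℚ using (ℚ; 0ℚ; 1/_; ≢-nonZero)
open import Data.Rational.Properties using (_≟_)
open import Data.Bool using (Bool; true; false; not; if_then_else_)
open import Data.List using (List; []; _∷_; _++_; replicate; take; drop; map; upTo)
open import Relation.Nullary using (yes; no)

-- Stern's diatomic integers: stern n m = [2^n : m] for 0 ≤ m ≤ 2^n
-- (values outside that range are junk and never used).
stern : ℕ → ℕ → ℕ
stern zero zero = 0
stern zero (suc zero) = 1
stern zero (suc (suc _)) = 0
stern (suc n) m =
  if m % 2 ≡ᵇ 0
  then stern n (m / 2)
  else stern n (m / 2) + stern n (suc (m / 2))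

-- {m}_n : the length-n binary word of m, most significant bit first
-- (true = 1, false = 0).
binWord : ℕ → ℕ → List Bool
binWord zero m = []
binWord (suc n) m = binWord n (m / 2) ++ (m % 2 ≡ᵇ 1) ∷ []

blocksFrom : Bool → List ℕ → List Bool
blocksFrom b [] = []
blocksFrom b (k ∷ ks) = replicate k b ++ blocksFrom (not b) ks

blocks : List ℕ → List Bool
blocks = blocksFrom true

-- k_i (default 0 outside the list; only used for valid indices)
kAt : List ℕ → ℕ → ℕ
kAt [] i = 0
kAt (k ∷ ks) zero = k
kAt (k ∷ ks) (suc i) = kAt ks i

seg : ℕ → ℕ → List ℕ → List ℕ
seg i j ks = take (suc j ∸ i) (drop i ks)

range : ℕ → ℕ → List ℕ
range a b = map (λ i → a + i) (upTo (suc b ∸ a))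

data ℚ∞ : Set where
  fin : ℚ → ℚ∞
  ∞   : ℚ∞

fromℕ∞ : ℕ → ℚ∞
fromℕ∞ k = fin (+ k ℚ./ 1)

recip : ℚ∞ → ℚ∞
recip ∞ = fin 0ℚ
recip (fin q) with q ≟ 0ℚ
... | yes _ = ∞
... | no q≢0 = fin (1/_ q {{≢-nonZero q≢0}})

addℕ : ℕ → ℚ∞ → ℚ∞
addℕ k (fin q) = fin (+ k ℚ./ 1 ℚ.+ q)
addℕ k ∞ = ∞

-- product (∞ absorbing; never occurs in the theorem's products)
mul∞ : ℚ∞ → ℚ∞ → ℚ∞
mul∞ (fin p) (fin q) = fin (p ℚ.* q)
mul∞ _ _ = ∞

prod∞ : List ℚ∞ → ℚ∞
prod∞ [] = fin (+ 1 ℚ./ 1)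
prod∞ (x ∷ xs) = mul∞ x (prod∞ xs)

∏[_to_] : ℕ → ℕ → (ℕ → ℚ∞) → ℚ∞
∏[ a to b ] f = prod∞ (map f (range a b))

-- Continued fraction CF(k₀, …, k_{l-1}); CF of the empty list is junk.
CF : List ℕ → ℚ∞
CF [] = fin 0ℚ
CF (k ∷ []) = fromℕ∞ k
CF (k ∷ k′ ∷ ks) = addℕ k (recip (CF (k′ ∷ ks)))

ratio : ℕ → ℕ → ℚ∞
ratio p zero = ∞
ratio p (suc q) = fin (+ p ℚ./ suc q)

{-# OPTIONS --safe #-}

-- Reading the bits of m from the most significant one, the pair ([2ⁿ:m], [2ⁿ:m+1]) evolves from
-- (0, 1) by (a, b) ↦ (a, a + b) on a 0 and (a, b) ↦ (a + b, b) on a 1, while the pair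
-- ([2ⁿ:2ⁿ-m], [2ⁿ:2ⁿ-m-1]) evolves in the same way from (1, 0). Running through the blocks
-- 1^{k₀} 0^{k₁} ⋯ 1^{k_{l-1}} of {m}ₙ thus expresses these Stern numbers as Euler continuants:
-- [2ⁿ:m] = K(k₀,…,k_{l-1}), [2ⁿ:m+1] = K(k₀,…,k_{l-2}) and [2ⁿ:2ⁿ-m] = K(k₁,…,k_{l-1}).
-- Since CF(k_j,…,k_{l-1}) = K(k_j,…,k_{l-1}) / K(k_{j+1},…,k_{l-1}) and K is invariant under
-- reversal, each formula is a telescoping product or a single quotient of continuants; the
-- hypotheses k_i ≥ 1 keep the intermediate continuants nonzero, and a trailing (leading) block
-- of length 0 drops the last (first) two entries without changing K.

module Submission where

open import Defs
open import Data.Nat using (ℕ; zero; suc; _+_; _*_; _∸_; _^_; _%_; _≤_; _<_; z≤n; s≤s; >-nonZero)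
open import Data.Nat.Properties
  using (+-identityʳ; +-comm; +-assoc; *-suc; +-suc; m≤m+n; m≤n+m; m≤n*m; ≤-trans; ≤-refl; module ≤-Reasoning; +-monoˡ-≤;
         m≤n⇒m≤1+n; n≤1+n; <⇒≤; m+n∸m≡n; m+[n∸m]≡n; *-cancelˡ-≡; suc-injective; m+1+n≢0; even≢odd; m≤n⇒∃[o]m+o≡n)
open import Data.Nat.DivMod using (_/_; m*n/n≡m; m*n%n≡0; [m+kn]%n≡m%n; +-distrib-/-∣ʳ)
open import Data.Nat.Divisibility using (divides-refl)
open import Data.Nat.Tactic.RingSolver using (solve-∀)
open import Data.Integer as ℤ using (+_)
import Data.Integer.Properties as ℤₚ
open import Data.Rational as ℚ using (ℚ; 0ℚ; 1ℚ; 1/_)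
import Data.Rational.Properties as ℚₚ
open import Data.Rational.Unnormalised as ℚᵘ using (mkℚᵘ; *≡*)
import Data.Rational.Unnormalised.Properties as ℚᵘₚ
open import Data.Bool using (Bool; true; false; not)
open import Data.List using (List; []; _∷_; _++_; _∷ʳ_; length; reverse; take; drop; applyUpTo; map; replicate; foldl)
open import Data.List.Properties using (take-all; take-drop; foldl-++; map-applyUpTo; unfold-reverse; reverse-++; ++-assoc)
open import Data.Product using (_×_; _,_; proj₁; proj₂; ∃; swap)
open import Data.Empty using (⊥-elim)
open import Function using (_∘_)
open import Relation.Nullary using (yes; no)
open import Relation.Binary.PropositionalEquality

frac : ℕ → ℕ → ℚ
frac p q = + p ℚ./ suc q

frac-cong : ∀ p q p′ q′ → p * suc q′ ≡ p′ * suc q → frac p q ≡ frac p′ q′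
frac-cong p q p′ q′ e = ℚₚ.fromℚᵘ-cong {mkℚᵘ (+ p) q} {mkℚᵘ (+ p′) q′} (*≡* (begin
  + p ℤ.* + suc q′    ≡⟨ ℤₚ.pos-* p (suc q′) ⟨
  + (p * suc q′)      ≡⟨ cong +_ e ⟩
  + (p′ * suc q)      ≡⟨ ℤₚ.pos-* p′ (suc q) ⟩
  + p′ ℤ.* + suc q    ∎))
  where open ≡-Reasoning

toℚᵘ-frac : ∀ p q → ℚ.toℚᵘ (frac p q) ℚᵘ.≃ mkℚᵘ (+ p) q
toℚᵘ-frac p q = ℚₚ.toℚᵘ-fromℚᵘ (mkℚᵘ (+ p) q)

frac-* : ∀ a b c d → frac a b ℚ.* frac c d ≡ frac (a * c) (d + b * suc d)
frac-* a b c d = ℚₚ.toℚᵘ-injective (begin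
  ℚ.toℚᵘ (frac a b ℚ.* frac c d)           ≈⟨ ℚₚ.toℚᵘ-homo-* (frac a b) (frac c d) ⟩
  ℚ.toℚᵘ (frac a b) ℚᵘ.* ℚ.toℚᵘ (frac c d) ≈⟨ ℚᵘₚ.*-cong (toℚᵘ-frac a b) (toℚᵘ-frac c d) ⟩
  mkℚᵘ (+ a ℤ.* + c) (d + b * suc d)       ≡⟨ cong (λ n → mkℚᵘ n (d + b * suc d)) (ℤₚ.pos-* a c) ⟨
  mkℚᵘ (+ (a * c)) (d + b * suc d)         ≈⟨ toℚᵘ-frac (a * c) (d + b * suc d) ⟨
  ℚ.toℚᵘ (frac (a * c) (d + b * suc d))    ∎)
  where open ℚᵘₚ.≃-Reasoning

frac-+ : ∀ a b c d → frac a b ℚ.+ frac c d ≡ frac (a * suc d + c * suc b) (d + b * suc d)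
frac-+ a b c d = ℚₚ.toℚᵘ-injective (begin
  ℚ.toℚᵘ (frac a b ℚ.+ frac c d)                   ≈⟨ ℚₚ.toℚᵘ-homo-+ (frac a b) (frac c d) ⟩
  ℚ.toℚᵘ (frac a b) ℚᵘ.+ ℚ.toℚᵘ (frac c d)         ≈⟨ ℚᵘₚ.+-cong (toℚᵘ-frac a b) (toℚᵘ-frac c d) ⟩
  mkℚᵘ (+ a ℤ.* + suc d ℤ.+ + c ℤ.* + suc b) D     ≡⟨ cong (λ n → mkℚᵘ n D) numerator ⟩
  mkℚᵘ (+ (a * suc d + c * suc b)) D               ≈⟨ toℚᵘ-frac (a * suc d + c * suc b) D ⟨
  ℚ.toℚᵘ (frac (a * suc d + c * suc b) D)          ∎)
  where
  open ℚᵘₚ.≃-Reasoning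
  D = d + b * suc d
  numerator : + a ℤ.* + suc d ℤ.+ + c ℤ.* + suc b ≡ + (a * suc d + c * suc b)
  numerator = trans (cong₂ ℤ._+_ (sym (ℤₚ.pos-* a (suc d))) (sym (ℤₚ.pos-* c (suc b))))
                    (sym (ℤₚ.pos-+ (a * suc d) (c * suc b)))

frac-zero : ∀ q → frac 0 q ≡ 0ℚ
frac-zero q = frac-cong 0 q 0 0 refl

frac-suc≢0 : ∀ p q → frac (suc p) q ≢ 0ℚ
frac-suc≢0 p q p≡0 = ℚₚ.<-irrefl (sym p≡0) (ℚₚ.positive⁻¹ (frac (suc p) q) {{ℚₚ.normalize-pos (suc p) (suc q)}})

1/-frac : ∀ p q .{{_ : ℚ.NonZero (frac (suc p) q)}} → 1/ frac (suc p) q ≡ frac (suc q) p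
1/-frac p q = begin
  1/ x                  ≡⟨ ℚₚ.*-identityʳ (1/ x) ⟨
  1/ x ℚ.* 1ℚ           ≡⟨ cong (1/ x ℚ.*_) x*y≡1 ⟨
  1/ x ℚ.* (x ℚ.* y)    ≡⟨ ℚₚ.*-assoc (1/ x) x y ⟨
  (1/ x ℚ.* x) ℚ.* y    ≡⟨ cong (ℚ._* y) (ℚₚ.*-inverseˡ x) ⟩
  1ℚ ℚ.* y              ≡⟨ ℚₚ.*-identityˡ y ⟩
  y                     ∎
  where
  open ≡-Reasoning
  x = frac (suc p) q
  y = frac (suc q) p
  x*y≡1 : x ℚ.* y ≡ 1ℚ
  x*y≡1 = trans (frac-* (suc p) q (suc q) p) (frac-cong (suc p * suc q) (p + q * suc p) 1 0 (identity p q))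
    where
    identity : ∀ p q → suc p * suc q * 1 ≡ 1 * suc (p + q * suc p)
    identity = solve-∀

recip-ratio : ∀ p q → 1 ≤ p + q → recip (ratio p q) ≡ ratio q p
recip-ratio zero (suc q) _ with frac 0 q ℚₚ.≟ 0ℚ
... | yes _ = refl
... | no 0≢0 = ⊥-elim (0≢0 (frac-zero q))
recip-ratio (suc p) zero _ = cong fin (sym (frac-zero p))
recip-ratio (suc p) (suc q) _ with frac (suc p) q ℚₚ.≟ 0ℚ
... | yes p≡0 = ⊥-elim (frac-suc≢0 p q p≡0)
... | no p≢0 = cong fin (1/-frac p q {{ℚ.≢-nonZero p≢0}})

addℕ-ratio : ∀ k q p → addℕ k (ratio q p) ≡ ratio (k * p + q) p
addℕ-ratio k q zero = refl
addℕ-ratio k q (suc p) =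
  cong fin (trans (frac-+ k 0 q p) (frac-cong (k * suc p + q * 1) (p + 0 * suc p) (k * suc p + q) p (identity k q p)))
  where
  identity : ∀ k q p → (k * suc p + q * 1) * suc p ≡ (k * suc p + q) * suc (p + 0 * suc p)
  identity = solve-∀

ratio-cancel : ∀ a b c → 1 ≤ b → mul∞ (ratio a b) (ratio b c) ≡ ratio a c
ratio-cancel a (suc b) zero _ = refl
ratio-cancel a (suc b) (suc c) _ =
  cong fin (trans (frac-* a b (suc b) c) (frac-cong (a * suc b) (c + b * suc c) a c (identity a b c)))
  where
  identity : ∀ a b c → a * suc b * suc c ≡ a * suc (c + b * suc c)
  identity = solve-∀

mul∞-identityʳ : ∀ x → mul∞ x (ratio 1 1) ≡ x
mul∞-identityʳ (fin p) = cong fin (ℚₚ.*-identityʳ p)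
mul∞-identityʳ ∞ = refl

mul∞-comm : ∀ x y → mul∞ x y ≡ mul∞ y x
mul∞-comm (fin p) (fin q) = cong fin (ℚₚ.*-comm p q)
mul∞-comm (fin p) ∞ = refl
mul∞-comm ∞ (fin q) = refl
mul∞-comm ∞ ∞ = refl

continuant : List ℕ → ℕ
continuant [] = 1
continuant (x ∷ []) = x
continuant (x ∷ y ∷ r) = x * continuant (y ∷ r) + continuant r

-- The value 0 on [] (rather than continuant [] = 1) is what makes continuant-∷ hold for every list.
continuant⁻ : List ℕ → ℕ
continuant⁻ [] = 0
continuant⁻ (x ∷ r) = continuant r

continuant-∷ : ∀ x xs → continuant (x ∷ xs) ≡ x * continuant xs + continuant⁻ xs
continuant-∷ x [] = sym (identity x)
  where
  identity : ∀ x → x * 1 + 0 ≡ x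
  identity = solve-∀
continuant-∷ x (y ∷ r) = refl

continuant-∷-mono : ∀ {x} xs → 1 ≤ x → continuant xs ≤ continuant (x ∷ xs)
continuant-∷-mono {x} xs 1≤x = begin
  continuant xs                          ≤⟨ m≤n*m (continuant xs) x {{>-nonZero 1≤x}} ⟩
  x * continuant xs                      ≤⟨ m≤m+n (x * continuant xs) (continuant⁻ xs) ⟩
  x * continuant xs + continuant⁻ xs     ≡⟨ continuant-∷ x xs ⟨
  continuant (x ∷ xs)                    ∎
  where open ≤-Reasoning

continuant-∷ʳ : ∀ xs y z → continuant (xs ++ y ∷ z ∷ []) ≡ z * continuant (xs ++ y ∷ []) + continuant xs
continuant-∷ʳ [] y z = identity y z
  where
  identity : ∀ y z → y * z + 1 ≡ z * y + 1
  identity = solve-∀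
continuant-∷ʳ (x ∷ []) y z = identity x y z
  where
  identity : ∀ x y z → x * (y * z + 1) + z ≡ z * (x * y + 1) + x
  identity = solve-∀
continuant-∷ʳ (x ∷ x′ ∷ r) y z
  rewrite continuant-∷ʳ (x′ ∷ r) y z | continuant-∷ʳ r y z =
    identity x (continuant (x′ ∷ r ++ y ∷ [])) (continuant (x′ ∷ r)) (continuant (r ++ y ∷ [])) (continuant r) z
  where
  identity : ∀ x A B C D z → x * (z * A + B) + (z * C + D) ≡ z * (x * A + C) + (x * B + D)
  identity = solve-∀

continuant-reverse : ∀ xs → continuant (reverse xs) ≡ continuant xs
continuant-reverse [] = refl
continuant-reverse (x ∷ []) = refl
continuant-reverse (x ∷ y ∷ r) = begin
  continuant (reverse (x ∷ y ∷ r))                          ≡⟨ cong continuant reverse-pair ⟩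
  continuant (reverse r ++ y ∷ x ∷ [])                      ≡⟨ continuant-∷ʳ (reverse r) y x ⟩
  x * continuant (reverse r ++ y ∷ []) + continuant (reverse r)
    ≡⟨ cong₂ (λ u v → x * u + v) (trans (cong continuant (sym (unfold-reverse y r))) (continuant-reverse (y ∷ r)))
                                 (continuant-reverse r) ⟩
  x * continuant (y ∷ r) + continuant r                     ∎
  where
  open ≡-Reasoning
  reverse-pair : reverse (x ∷ y ∷ r) ≡ reverse r ++ y ∷ x ∷ []
  reverse-pair = begin
    reverse (x ∷ y ∷ r)               ≡⟨ unfold-reverse x (y ∷ r) ⟩
    reverse (y ∷ r) ++ x ∷ []         ≡⟨ cong (_++ x ∷ []) (unfold-reverse y r) ⟩
    (reverse r ++ y ∷ []) ++ x ∷ []   ≡⟨ ++-assoc (reverse r) (y ∷ []) (x ∷ []) ⟩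
    reverse r ++ y ∷ x ∷ []           ∎

continuant-consecutive-pos : ∀ y r → 1 ≤ continuant (y ∷ r) + continuant r
continuant-consecutive-pos y [] = m≤n+m 1 y
continuant-consecutive-pos y (z ∷ r) = begin
  1                                         ≤⟨ continuant-consecutive-pos z r ⟩
  continuant (z ∷ r) + continuant r         ≡⟨ +-comm (continuant (z ∷ r)) (continuant r) ⟩
  continuant r + continuant (z ∷ r)
    ≤⟨ +-monoˡ-≤ (continuant (z ∷ r)) (m≤n+m (continuant r) (y * continuant (z ∷ r))) ⟩
  continuant (y ∷ z ∷ r) + continuant (z ∷ r) ∎
  where open ≤-Reasoning

CF≡ratio-continuant : ∀ x xs → CF (x ∷ xs) ≡ ratio (continuant (x ∷ xs)) (continuant xs)
CF≡ratio-continuant x [] = refl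
CF≡ratio-continuant x (y ∷ r) = begin
  addℕ x (recip (CF (y ∷ r)))                              ≡⟨ cong (addℕ x ∘ recip) (CF≡ratio-continuant y r) ⟩
  addℕ x (recip (ratio (continuant (y ∷ r)) (continuant r)))
    ≡⟨ cong (addℕ x) (recip-ratio _ _ (continuant-consecutive-pos y r)) ⟩
  addℕ x (ratio (continuant r) (continuant (y ∷ r)))       ≡⟨ addℕ-ratio x (continuant r) (continuant (y ∷ r)) ⟩
  ratio (continuant (x ∷ y ∷ r)) (continuant (y ∷ r))       ∎
  where open ≡-Reasoning

CF-reverse-∷ʳ : ∀ xs x → CF (reverse (xs ++ x ∷ [])) ≡ ratio (continuant (xs ++ x ∷ [])) (continuant xs)
CF-reverse-∷ʳ xs x = begin
  CF (reverse (xs ++ x ∷ []))                                     ≡⟨ cong CF (reverse-++ xs (x ∷ [])) ⟩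
  CF (x ∷ reverse xs)                                             ≡⟨ CF≡ratio-continuant x (reverse xs) ⟩
  ratio (continuant (x ∷ reverse xs)) (continuant (reverse xs))
    ≡⟨ cong₂ ratio continuant-reversed (continuant-reverse xs) ⟩
  ratio (continuant (xs ++ x ∷ [])) (continuant xs)              ∎
  where
  open ≡-Reasoning
  continuant-reversed : continuant (x ∷ reverse xs) ≡ continuant (xs ++ x ∷ [])
  continuant-reversed = trans (cong continuant (sym (reverse-++ xs (x ∷ [])))) (continuant-reverse (xs ++ x ∷ []))

PositivePrefix : ℕ → List ℕ → Set
PositivePrefix j xs = ∀ i → i < j → 1 ≤ kAt xs i

continuant-take-pos : ∀ j xs → PositivePrefix j xs → 1 ≤ continuant (take j xs)
continuant-take-pos zero xs _ = ≤-refl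
continuant-take-pos (suc j) [] _ = ≤-refl
continuant-take-pos (suc j) (x ∷ xs) pos =
  ≤-trans (continuant-take-pos j xs (λ i i<j → pos (suc i) (s≤s i<j)))
          (continuant-∷-mono (take j xs) (pos 0 (s≤s z≤n)))

take-suc-kAt : ∀ xs j → j < length xs → take (suc j) xs ≡ take j xs ++ kAt xs j ∷ []
take-suc-kAt (x ∷ xs) zero _ = refl
take-suc-kAt (x ∷ xs) (suc j) (s≤s j<) = cong (x ∷_) (take-suc-kAt xs j j<)

applyUpTo-cong : ∀ {A : Set} {f g : ℕ → A} n → (∀ j → j < n → f j ≡ g j) → applyUpTo f n ≡ applyUpTo g n
applyUpTo-cong zero _ = refl
applyUpTo-cong (suc n) f≡g = cong₂ _∷_ (f≡g 0 (s≤s z≤n)) (applyUpTo-cong n (λ j j<n → f≡g (suc j) (s≤s j<n)))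

∏-applyUpTo : ∀ a b f → ∏[ a to b ] f ≡ prod∞ (applyUpTo (λ i → f (a + i)) (suc b ∸ a))
∏-applyUpTo a b f = cong prod∞ (trans (cong (map f) (map-applyUpTo (λ i → i) (λ i → a + i) (suc b ∸ a)))
                                      (map-applyUpTo (λ i → a + i) f (suc b ∸ a)))

telescope : ∀ (h : ℕ → ℕ) L → (∀ j → j < L → 1 ≤ h (suc j)) →
  prod∞ (applyUpTo (λ j → ratio (h (suc j)) (h j)) (suc L)) ≡ ratio (h (suc L)) (h 0)
telescope h zero _ = mul∞-identityʳ (ratio (h 1) (h 0))
telescope h (suc L) pos = begin
  mul∞ (ratio (h 1) (h 0)) (prod∞ (applyUpTo (λ j → ratio (h (suc (suc j))) (h (suc j))) (suc L)))
    ≡⟨ cong (mul∞ (ratio (h 1) (h 0))) (telescope (h ∘ suc) L (λ j j<L → pos (suc j) (s≤s j<L))) ⟩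
  mul∞ (ratio (h 1) (h 0)) (ratio (h (suc (suc L))) (h 1))
    ≡⟨ mul∞-comm (ratio (h 1) (h 0)) _ ⟩
  mul∞ (ratio (h (suc (suc L))) (h 1)) (ratio (h 1) (h 0))
    ≡⟨ ratio-cancel (h (suc (suc L))) (h 1) (h 0) (pos 0 (s≤s z≤n)) ⟩
  ratio (h (suc (suc L))) (h 0) ∎
  where open ≡-Reasoning

prod∞-CF-suffixes : ∀ L y ys → L ≤ length ys → PositivePrefix L ys →
  prod∞ (applyUpTo (λ j → CF (drop j (y ∷ take L ys))) (suc L)) ≡ ratio (continuant (y ∷ take L ys)) 1
prod∞-CF-suffixes zero y ys _ _ = mul∞-identityʳ (ratio y 1)
prod∞-CF-suffixes (suc L) y (z ∷ zs) (s≤s L≤) pos = begin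
  mul∞ (CF (y ∷ z ∷ t)) (prod∞ (applyUpTo (λ j → CF (drop j (z ∷ t))) (suc L)))
    ≡⟨ cong₂ mul∞ (CF≡ratio-continuant y (z ∷ t)) (prod∞-CF-suffixes L z zs L≤ (λ i i<L → pos (suc i) (s≤s i<L))) ⟩
  mul∞ (ratio (continuant (y ∷ z ∷ t)) (continuant (z ∷ t))) (ratio (continuant (z ∷ t)) 1)
    ≡⟨ ratio-cancel (continuant (y ∷ z ∷ t)) (continuant (z ∷ t)) 1 (continuant-take-pos (suc L) (z ∷ zs) pos) ⟩
  ratio (continuant (y ∷ z ∷ t)) 1 ∎
  where
  open ≡-Reasoning
  t = take L zs

prod∞-CF-reversed-prefixes : ∀ L xs → L < length xs → PositivePrefix L xs →
  prod∞ (applyUpTo (λ j → CF (reverse (take (suc j) xs))) (suc L)) ≡ ratio (continuant (take (suc L) xs)) 1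
prod∞-CF-reversed-prefixes L xs L<len pos =
  trans (cong prod∞ (applyUpTo-cong (suc L) factor)) (telescope (λ j → continuant (take j xs)) L prefix-pos)
  where
  factor : ∀ j → j < suc L →
    CF (reverse (take (suc j) xs)) ≡ ratio (continuant (take (suc j) xs)) (continuant (take j xs))
  factor j j≤L = begin
    CF (reverse (take (suc j) xs))                               ≡⟨ cong (CF ∘ reverse) split ⟩
    CF (reverse (take j xs ++ kAt xs j ∷ []))                    ≡⟨ CF-reverse-∷ʳ (take j xs) (kAt xs j) ⟩
    ratio (continuant (take j xs ++ kAt xs j ∷ [])) (continuant (take j xs))
      ≡⟨ cong (λ t → ratio (continuant t) (continuant (take j xs))) split ⟨
    ratio (continuant (take (suc j) xs)) (continuant (take j xs)) ∎
    where
    open ≡-Reasoning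
    split = take-suc-kAt xs j (≤-trans j≤L L<len)
  prefix-pos : ∀ j → j < L → 1 ≤ continuant (take (suc j) xs)
  prefix-pos j j<L = continuant-take-pos (suc j) xs (λ i i≤j → pos i (≤-trans i≤j j<L))

step : ℕ × ℕ → Bool → ℕ × ℕ
step (a , b) false = (a , a + b)
step (a , b) true = (a + b , b)

run : ℕ × ℕ → List Bool → ℕ × ℕ
run = foldl step

run-∷ʳ : ∀ v w b → run v (w ∷ʳ b) ≡ step (run v w) b
run-∷ʳ v w b = foldl-++ step v w (b ∷ [])

step-swap : ∀ v b → step (swap v) b ≡ swap (step v (not b))
step-swap (a , c) false = cong (c ,_) (+-comm c a)
step-swap (a , c) true = cong (_, a) (+-comm c a)

bit : Bool → ℕ → ℕ
bit false h = h * 2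
bit true h = suc (h * 2)

data Halves : ℕ → Set where
  half : ∀ b h → Halves (bit b h)

halves : ∀ m → Halves m
halves zero = half false 0
halves (suc m) with halves m
... | half false h = half true h
... | half true h = half false (suc h)

even-%2 : ∀ h → h * 2 % 2 ≡ 0
even-%2 h = m*n%n≡0 h 2

even-/2 : ∀ h → h * 2 / 2 ≡ h
even-/2 h = m*n/n≡m h 2

odd-%2 : ∀ h → suc (h * 2) % 2 ≡ 1
odd-%2 h = [m+kn]%n≡m%n 1 h 2

odd-/2 : ∀ h → suc (h * 2) / 2 ≡ h
odd-/2 h = trans (+-distrib-/-∣ʳ 1 {h * 2} {2} (divides-refl h)) (m*n/n≡m h 2)

binWord-bit : ∀ n b h → binWord (suc n) (bit b h) ≡ binWord n h ∷ʳ b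
binWord-bit n false h rewrite even-%2 h | even-/2 h = refl
binWord-bit n true h rewrite odd-%2 h | odd-/2 h = refl

stern-even : ∀ n h → stern (suc n) (h * 2) ≡ stern n h
stern-even n h rewrite even-%2 h | even-/2 h = refl

stern-odd : ∀ n h → stern (suc n) (suc (h * 2)) ≡ stern n h + stern n (suc h)
stern-odd n h rewrite odd-%2 h | odd-/2 h = refl

sternPair : ℕ → ℕ → ℕ × ℕ
sternPair n m = (stern n m , stern n (suc m))

sternPair-bit : ∀ n b h → sternPair (suc n) (bit b h) ≡ step (sternPair n h) b
sternPair-bit n false h = cong₂ _,_ (stern-even n h) (stern-odd n h)
sternPair-bit n true h = cong₂ _,_ (stern-odd n h) (stern-even n (suc h))

run-binWord-bit : ∀ v n b h → run v (binWord (suc n) (bit b h)) ≡ step (run v (binWord n h)) b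
run-binWord-bit v n b h = trans (cong (run v) (binWord-bit n b h)) (run-∷ʳ v (binWord n h) b)

-- When m + 1 + c = 2ⁿ, the n-bit words of m and c are bitwise complements, which is why
-- the run from (1 , 0) along the word of m tracks the Stern pair of c.
BinWordRuns : ℕ → ℕ → ℕ → Set
BinWordRuns n m c = run (0 , 1) (binWord n m) ≡ sternPair n m × run (1 , 0) (binWord n m) ≡ swap (sternPair n c)

binWordRuns-bit : ∀ n b h c → BinWordRuns n h c → BinWordRuns (suc n) (bit b h) (bit (not b) c)
binWordRuns-bit n b h c (run₀₁ , run₁₀) = left , right
  where
  open ≡-Reasoning
  left = begin
    run (0 , 1) (binWord (suc n) (bit b h))  ≡⟨ run-binWord-bit (0 , 1) n b h ⟩
    step (run (0 , 1) (binWord n h)) b       ≡⟨ cong (λ v → step v b) run₀₁ ⟩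
    step (sternPair n h) b                   ≡⟨ sternPair-bit n b h ⟨
    sternPair (suc n) (bit b h)              ∎
  right = begin
    run (1 , 0) (binWord (suc n) (bit b h))  ≡⟨ run-binWord-bit (1 , 0) n b h ⟩
    step (run (1 , 0) (binWord n h)) b       ≡⟨ cong (λ v → step v b) run₁₀ ⟩
    step (swap (sternPair n c)) b            ≡⟨ step-swap (sternPair n c) b ⟩
    swap (step (sternPair n c) (not b))      ≡⟨ cong swap (sternPair-bit n (not b) c) ⟨
    swap (sternPair (suc n) (bit (not b) c)) ∎

bit-complement : ∀ b h c → bit b h + suc (bit (not b) c) ≡ 2 * (h + suc c)
bit-complement false h c = identity h c
  where
  identity : ∀ h c → h * 2 + suc (suc (c * 2)) ≡ 2 * (h + suc c)
  identity = solve-∀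
bit-complement true h c = identity h c
  where
  identity : ∀ h c → suc (h * 2) + suc (c * 2) ≡ 2 * (h + suc c)
  identity = solve-∀

halve-complement : ∀ n b h c → bit b h + suc (bit (not b) c) ≡ 2 ^ suc n → h + suc c ≡ 2 ^ n
halve-complement n b h c e = *-cancelˡ-≡ (h + suc c) (2 ^ n) 2 (trans (sym (bit-complement b h c)) e)

binWordRuns : ∀ n m c → m + suc c ≡ 2 ^ n → BinWordRuns n m c
binWordRuns zero zero zero _ = refl , refl
binWordRuns zero (suc m) c e = ⊥-elim (m+1+n≢0 m (suc-injective e))
binWordRuns (suc n) m c e with halves m | halves c
... | half false h | half true c′ = binWordRuns-bit n false h c′ (binWordRuns n h c′ (halve-complement n false h c′ e))
... | half true h | half false c′ = binWordRuns-bit n true h c′ (binWordRuns n h c′ (halve-complement n true h c′ e))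
... | half false h | half false c′ = ⊥-elim (even≢odd (2 ^ n) (h + c′) (trans (sym e) (identity h c′)))
  where
  identity : ∀ h c → h * 2 + suc (c * 2) ≡ suc (2 * (h + c))
  identity = solve-∀
... | half true h | half true c′ = ⊥-elim (even≢odd (2 ^ n) (h + suc c′) (trans (sym e) (identity h c′)))
  where
  identity : ∀ h c → suc (h * 2) + suc (suc (c * 2)) ≡ suc (2 * (h + suc c))
  identity = solve-∀

run-replicate-true : ∀ k x y w → run (x , y) (replicate k true ++ w) ≡ run (x + k * y , y) w
run-replicate-true zero x y w = cong (λ z → run (z , y) w) (sym (+-identityʳ x))
run-replicate-true (suc k) x y w =
  trans (run-replicate-true k (x + y) y w) (cong (λ z → run (z , y) w) (+-assoc x y (k * y)))

run-replicate-false : ∀ k x y w → run (x , y) (replicate k false ++ w) ≡ run (x , y + k * x) w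
run-replicate-false zero x y w = cong (λ z → run (x , z) w) (sym (+-identityʳ y))
run-replicate-false (suc k) x y w =
  trans (run-replicate-false k x (x + y) w) (cong (λ z → run (x , z) w) (identity x y k))
  where
  identity : ∀ x y k → x + y + k * x ≡ y + (x + k * x)
  identity = solve-∀

init : List ℕ → List ℕ
init [] = []
init (x ∷ []) = []
init (x ∷ y ∷ r) = x ∷ init (y ∷ r)

continuantForm : ℕ × ℕ → List ℕ → ℕ
continuantForm (x , y) ks = x * continuant⁻ ks + y * continuant ks

continuantForm-∷∷ : ∀ x y a b xs →
  continuantForm (x + a * y , y + b * (x + a * y)) xs ≡ continuantForm (x , y) (a ∷ b ∷ xs)
continuantForm-∷∷ x y a b xs =
  trans (identity x y a b (continuant⁻ xs) (continuant xs))
        (cong (λ K → x * K + y * (a * K + continuant xs)) (sym (continuant-∷ b xs)))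
  where
  identity : ∀ x y a b P Q → (x + a * y) * P + (y + b * (x + a * y)) * Q ≡ x * (b * Q + P) + y * (a * (b * Q + P) + Q)
  identity = solve-∀

data OddLength : List ℕ → Set where
  singleton : ∀ k → OddLength (k ∷ [])
  cons₂ : ∀ a b {ks} → OddLength ks → OddLength (a ∷ b ∷ ks)

oddLength : ∀ ks t → length ks ≡ 1 + 2 * t → OddLength ks
oddLength (k ∷ []) zero _ = singleton k
oddLength (k ∷ []) (suc t) e with () ← suc-injective (trans e (cong suc (*-suc 2 t)))
oddLength (k ∷ k′ ∷ ks) (suc t) e =
  cons₂ k k′ (oddLength ks t (suc-injective (suc-injective (trans e (cong suc (*-suc 2 t))))))

run-blocks : ∀ v {ks} → OddLength ks → run v (blocks ks) ≡ (continuantForm v ks , continuantForm v (init ks))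
run-blocks (x , y) (singleton k) = trans (run-replicate-true k x y []) (cong₂ _,_ (identity₁ x y k) (identity₂ x y))
  where
  identity₁ : ∀ x y k → x + k * y ≡ x * 1 + y * k
  identity₁ = solve-∀
  identity₂ : ∀ x y → y ≡ x * 0 + y * 1
  identity₂ = solve-∀
run-blocks (x , y) (cons₂ a b {c ∷ r} odd) = begin
  run (x , y) (blocks (a ∷ b ∷ c ∷ r))                      ≡⟨ run-replicate-true a x y _ ⟩
  run (x′ , y) (replicate b false ++ blocks (c ∷ r))       ≡⟨ run-replicate-false b x′ y _ ⟩
  run (x′ , y′) (blocks (c ∷ r))                            ≡⟨ run-blocks (x′ , y′) odd ⟩
  (continuantForm (x′ , y′) (c ∷ r) , continuantForm (x′ , y′) (init (c ∷ r)))
    ≡⟨ cong₂ _,_ (continuantForm-∷∷ x y a b (c ∷ r)) (continuantForm-∷∷ x y a b (init (c ∷ r))) ⟩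
  (continuantForm (x , y) (a ∷ b ∷ c ∷ r) , continuantForm (x , y) (init (a ∷ b ∷ c ∷ r))) ∎
  where
  open ≡-Reasoning
  x′ = x + a * y
  y′ = y + b * x′

stern≡continuants : ∀ n m c ks → m + suc c ≡ 2 ^ n → OddLength ks → binWord n m ≡ blocks ks →
  stern n m ≡ continuant ks × stern n (suc m) ≡ continuant (init ks) × stern n (suc c) ≡ continuant⁻ ks
stern≡continuants n m c ks e odd w =
  trans (cong proj₁ pair₀₁) (form₀₁ ks) ,
  trans (cong proj₂ pair₀₁) (form₀₁ (init ks)) ,
  trans (cong proj₁ pair₁₀) (form₁₀ ks)
  where
  runs = binWordRuns n m c e
  pair₀₁ : sternPair n m ≡ (continuantForm (0 , 1) ks , continuantForm (0 , 1) (init ks))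
  pair₀₁ = trans (sym (proj₁ runs)) (trans (cong (run (0 , 1)) w) (run-blocks (0 , 1) odd))
  pair₁₀ : swap (sternPair n c) ≡ (continuantForm (1 , 0) ks , continuantForm (1 , 0) (init ks))
  pair₁₀ = trans (sym (proj₂ runs)) (trans (cong (run (1 , 0)) w) (run-blocks (1 , 0) odd))
  form₀₁ : ∀ xs → continuantForm (0 , 1) xs ≡ continuant xs
  form₀₁ xs = +-identityʳ (continuant xs)
  form₁₀ : ∀ xs → continuantForm (1 , 0) xs ≡ continuant⁻ xs
  form₁₀ xs = trans (+-identityʳ _) (+-identityʳ (continuant⁻ xs))

seg≡drop-take : ∀ j L (xs : List ℕ) → j ≤ suc L → seg j L xs ≡ drop j (take (suc L) xs)
seg≡drop-take j L xs j≤ = trans (take-drop (suc L ∸ j) j xs) (cong (λ n → drop j (take n xs)) (m+[n∸m]≡n j≤))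

∏-CF-segments : ∀ L y ys → L ≤ length ys → PositivePrefix L ys →
  ∏[ 0 to L ] (λ j → CF (seg j L (y ∷ ys))) ≡ ratio (continuant (y ∷ take L ys)) 1
∏-CF-segments L y ys L≤len pos = begin
  ∏[ 0 to L ] (λ j → CF (seg j L (y ∷ ys)))                         ≡⟨ ∏-applyUpTo 0 L _ ⟩
  prod∞ (applyUpTo (λ j → CF (seg j L (y ∷ ys))) (suc L))           ≡⟨ cong prod∞ (applyUpTo-cong (suc L) segment) ⟩
  prod∞ (applyUpTo (λ j → CF (drop j (y ∷ take L ys))) (suc L))    ≡⟨ prod∞-CF-suffixes L y ys L≤len pos ⟩
  ratio (continuant (y ∷ take L ys)) 1                              ∎
  where
  open ≡-Reasoning
  segment : ∀ j → j < suc L → CF (seg j L (y ∷ ys)) ≡ CF (drop j (y ∷ take L ys))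
  segment j j<L+1 = cong CF (seg≡drop-take j L (y ∷ ys) (<⇒≤ j<L+1))

InteriorPositive : List ℕ → Set
InteriorPositive ks = ∀ i → 1 ≤ i → i + 2 ≤ length ks → 1 ≤ kAt ks i

interior-tail : ∀ k rest → InteriorPositive (k ∷ rest) → ∀ i → suc i < length rest → 1 ≤ kAt rest i
interior-tail k rest pos i i+1<len = pos (suc i) (s≤s z≤n) (s≤s (subst (_≤ length rest) (+-comm 2 i) i+1<len))

positivePrefix-last : ∀ k xs → (∀ i → suc i < length xs → 1 ≤ kAt xs i) → 1 ≤ kAt (k ∷ xs) (length xs) →
  PositivePrefix (length xs) xs
positivePrefix-last k (x ∷ []) _ last zero _ = last
positivePrefix-last k (x ∷ y ∷ ys) init _ zero _ = init 0 (s≤s (s≤s z≤n))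
positivePrefix-last k (x ∷ xs) init last (suc i) (s≤s i<len) =
  positivePrefix-last x xs (λ j j+1<len → init (suc j) (s≤s j+1<len)) last i i<len

∏-CF-suffixes : ∀ k rest → InteriorPositive (k ∷ rest) → 1 ≤ kAt (k ∷ rest) (length rest) →
  ∏[ 0 to length rest ] (λ j → CF (seg j (length rest) (k ∷ rest))) ≡ ratio (continuant (k ∷ rest)) 1
∏-CF-suffixes k rest pos last =
  trans (∏-CF-segments (length rest) k rest ≤-refl (positivePrefix-last k rest (interior-tail k rest pos) last))
        (cong (λ t → ratio (continuant (k ∷ t)) 1) (take-all (length rest) rest ≤-refl))

split-last-two : ∀ x y r →
  x ∷ y ∷ r ≡ take (length r) (x ∷ y ∷ r) ++ kAt (x ∷ y ∷ r) (length r) ∷ kAt (x ∷ y ∷ r) (suc (length r)) ∷ []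
split-last-two x y [] = refl
split-last-two x y (z ∷ r) = cong (x ∷_) (split-last-two y z r)

∏-CF-suffixes-last≡0 : ∀ ks → InteriorPositive ks → kAt ks (length ks ∸ 1) ≡ 0 → 3 ≤ length ks →
  ∏[ 0 to length ks ∸ 3 ] (λ j → CF (seg j (length ks ∸ 3) ks)) ≡ ratio (continuant ks) 1
∏-CF-suffixes-last≡0 (k₀ ∷ []) _ _ (s≤s ())
∏-CF-suffixes-last≡0 (k₀ ∷ k₁ ∷ []) _ _ (s≤s (s≤s ()))
∏-CF-suffixes-last≡0 (k₀ ∷ k₁ ∷ k₂ ∷ r) pos last≡0 _ =
  trans (∏-CF-segments (length r) k₀ (k₁ ∷ k₂ ∷ r) (m≤n⇒m≤1+n (n≤1+n (length r))) prefix-pos)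
        (cong (λ K → ratio K 1) (sym drop-last-two))
  where
  ks′ = k₀ ∷ take (length r) (k₁ ∷ k₂ ∷ r)
  a = kAt (k₁ ∷ k₂ ∷ r) (length r)
  prefix-pos : PositivePrefix (length r) (k₁ ∷ k₂ ∷ r)
  prefix-pos i i<len = interior-tail k₀ (k₁ ∷ k₂ ∷ r) pos i (s≤s (m≤n⇒m≤1+n i<len))
  drop-last-two : continuant (k₀ ∷ k₁ ∷ k₂ ∷ r) ≡ continuant ks′
  drop-last-two = begin
    continuant (k₀ ∷ k₁ ∷ k₂ ∷ r)                                  ≡⟨ cong (continuant ∘ (k₀ ∷_)) (split-last-two k₁ k₂ r) ⟩
    continuant (ks′ ++ a ∷ kAt (k₁ ∷ k₂ ∷ r) (suc (length r)) ∷ [])  ≡⟨ continuant-∷ʳ ks′ a _ ⟩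
    kAt (k₁ ∷ k₂ ∷ r) (suc (length r)) * continuant (ks′ ++ a ∷ []) + continuant ks′
      ≡⟨ cong (λ z → z * continuant (ks′ ++ a ∷ []) + continuant ks′) last≡0 ⟩
    continuant ks′                                                  ∎
    where open ≡-Reasoning

prod∞-CF-reversed-prefixes-all : ∀ x xs → PositivePrefix (length xs) (x ∷ xs) →
  prod∞ (applyUpTo (λ j → CF (reverse (take (suc j) (x ∷ xs)))) (suc (length xs))) ≡ ratio (continuant (x ∷ xs)) 1
prod∞-CF-reversed-prefixes-all x xs pos =
  trans (prod∞-CF-reversed-prefixes (length xs) (x ∷ xs) ≤-refl pos)
        (cong (λ t → ratio (continuant (x ∷ t)) 1) (take-all (length xs) xs ≤-refl))

∏-CF-reversed-prefixes : ∀ k rest → InteriorPositive (k ∷ rest) → 1 ≤ k →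
  ∏[ 0 to length rest ] (λ j → CF (reverse (seg 0 j (k ∷ rest)))) ≡ ratio (continuant (k ∷ rest)) 1
∏-CF-reversed-prefixes k rest pos k≥1 =
  trans (∏-applyUpTo 0 (length rest) _) (prod∞-CF-reversed-prefixes-all k rest prefix-pos)
  where
  prefix-pos : PositivePrefix (length rest) (k ∷ rest)
  prefix-pos zero _ = k≥1
  prefix-pos (suc i) i+1<len = interior-tail k rest pos i i+1<len

∏-CF-reversed-prefixes-first≡0 : ∀ ks → InteriorPositive ks → kAt ks 0 ≡ 0 → 3 ≤ length ks →
  ∏[ 2 to length ks ∸ 1 ] (λ j → CF (reverse (seg 2 j ks))) ≡ ratio (continuant ks) 1
∏-CF-reversed-prefixes-first≡0 (k₀ ∷ []) _ _ (s≤s ())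
∏-CF-reversed-prefixes-first≡0 (k₀ ∷ k₁ ∷ []) _ _ (s≤s (s≤s ()))
∏-CF-reversed-prefixes-first≡0 (.0 ∷ k₁ ∷ c ∷ r) pos refl _ =
  trans (∏-applyUpTo 2 (2 + length r) _) (prod∞-CF-reversed-prefixes-all c r prefix-pos)
  where
  prefix-pos : PositivePrefix (length r) (c ∷ r)
  prefix-pos i i<len = interior-tail 0 (k₁ ∷ c ∷ r) pos (suc i) (s≤s (s≤s i<len))

seg-all : ∀ (k : ℕ) rest → seg 0 (length rest) (k ∷ rest) ≡ k ∷ rest
seg-all k rest = cong (k ∷_) (take-all (length rest) rest ≤-refl)

init-∷ʳ-last : ∀ x xs → ∃ λ y → x ∷ xs ≡ init (x ∷ xs) ++ y ∷ []
init-∷ʳ-last x [] = x , refl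
init-∷ʳ-last x (y ∷ r) = let z , eq = init-∷ʳ-last y r in z , cong (x ∷_) eq

CF-reverse≡ratio-continuant : ∀ x xs →
  CF (reverse (x ∷ xs)) ≡ ratio (continuant (x ∷ xs)) (continuant (init (x ∷ xs)))
CF-reverse≡ratio-continuant x xs = begin
  CF (reverse (x ∷ xs))                                     ≡⟨ cong (CF ∘ reverse) split ⟩
  CF (reverse (init (x ∷ xs) ++ y ∷ []))                    ≡⟨ CF-reverse-∷ʳ (init (x ∷ xs)) y ⟩
  ratio (continuant (init (x ∷ xs) ++ y ∷ [])) (continuant (init (x ∷ xs)))
    ≡⟨ cong (λ t → ratio (continuant t) (continuant (init (x ∷ xs)))) split ⟨
  ratio (continuant (x ∷ xs)) (continuant (init (x ∷ xs)))  ∎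
  where
  open ≡-Reasoning
  y = proj₁ (init-∷ʳ-last x xs)
  split = proj₂ (init-∷ʳ-last x xs)

complement : ∀ {m k} → m < k → ∃ λ c → m + suc c ≡ k
complement {m} m<k = let c , e = m≤n⇒∃[o]m+o≡n m<k in c , trans (+-suc m c) e

∸-complement : ∀ m c {k} → m + suc c ≡ k → k ∸ m ≡ suc c
∸-complement m c e = trans (cong (_∸ m) (sym e)) (m+n∸m≡n m (suc c))

theorem4p9 : (n m : ℕ) → m < 2 ^ n → (ks : List ℕ) →
    (∃ λ t → length ks ≡ 1 + 2 * t) →
    (∀ i → 1 ≤ i → i + 2 ≤ length ks → 1 ≤ kAt ks i) →
    binWord n m ≡ blocks ks →
    ((1 ≤ kAt ks (length ks ∸ 1) →
        fromℕ∞ (stern n m) ≡ ∏[ 0 to length ks ∸ 1 ] (λ j → CF (seg j (length ks ∸ 1) ks)))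
    × (kAt ks (length ks ∸ 1) ≡ 0 → 3 ≤ length ks →
        fromℕ∞ (stern n m) ≡ ∏[ 0 to length ks ∸ 3 ] (λ j → CF (seg j (length ks ∸ 3) ks)))
    × (1 ≤ kAt ks 0 →
        fromℕ∞ (stern n m) ≡ ∏[ 0 to length ks ∸ 1 ] (λ j → CF (reverse (seg 0 j ks))))
    × (kAt ks 0 ≡ 0 → 3 ≤ length ks →
        fromℕ∞ (stern n m) ≡ ∏[ 2 to length ks ∸ 1 ] (λ j → CF (reverse (seg 2 j ks))))
    × (ratio (stern n m) (stern n (2 ^ n ∸ m)) ≡ CF (seg 0 (length ks ∸ 1) ks))
    × (ratio (stern n m) (stern n (suc m)) ≡ CF (reverse (seg 0 (length ks ∸ 1) ks))))
theorem4p9 n m m<2ⁿ [] (_ , ())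
theorem4p9 n m m<2ⁿ (k ∷ rest) (t , len) pos w
  with c , m+1+c≡2ⁿ ← complement m<2ⁿ
  with stern≡K , stern-suc≡K-init , stern-complement≡K-tail
         ← stern≡continuants n m c (k ∷ rest) m+1+c≡2ⁿ (oddLength (k ∷ rest) t len) w
  rewrite ∸-complement m c m+1+c≡2ⁿ | stern≡K | stern-suc≡K-init | stern-complement≡K-tail =
    (λ last≥1 → sym (∏-CF-suffixes k rest pos last≥1)) ,
    (λ last≡0 l≥3 → sym (∏-CF-suffixes-last≡0 (k ∷ rest) pos last≡0 l≥3)) ,
    (λ k≥1 → sym (∏-CF-reversed-prefixes k rest pos k≥1)) ,
    (λ k≡0 l≥3 → sym (∏-CF-reversed-prefixes-first≡0 (k ∷ rest) pos k≡0 l≥3)) ,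
    sym (trans (cong CF (seg-all k rest)) (CF≡ratio-continuant k rest)) ,
    sym (trans (cong (CF ∘ reverse) (seg-all k rest)) (CF-reverse≡ratio-continuant k rest))
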